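{- Let $\Delta\geq 1$, and let $n$ and $m\geq 1$ be integers with $m\leq \frac{\Delta n}{2}$ and $m\equiv 0\pmod{\binom{\Delta+1}{2}}$. Then there is a graph $G$ with $n$ vertices, $m$ edges and maximum degree $\Delta$ such that \[c(G)=1+n+\left(\frac{2^{\Delta+1}-\Delta-2}{\binom{\Delta+1}{2}}\right)m.\]
   Context: All graphs are finite, simple and undirected. A clique is a (possibly empty) set of pairwise adjacent vertices; $c(G)$ denotes the number of cliques of $G$ (including $\emptyset$ and single vertices). -}

module Defs where

open import Data.Nat using (ℕ; zero; suc; _+_; _≤_; _<ᵇ_)
open import Data.Bool using (Bool; true; false; _∧_; _∨_; not; if_then_else_)
open import Data.Fin using (Fin; zero; suc; toℕ; _≟_)
open import Data.List using (List; []; _∷_; concatMap)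
open import Data.Product using (Σ; _×_)
open import Relation.Binary.PropositionalEquality using (_≡_)
open import Relation.Nullary.Decidable using (⌊_⌋)

record Graph (n : ℕ) : Set where
  field
    adj    : Fin n → Fin n → Bool
    symm   : ∀ i j → adj i j ≡ adj j i
    irrefl : ∀ i → adj i i ≡ false
open Graph public

countFin : ∀ {n} → (Fin n → Bool) → ℕ
countFin {zero}  p = 0
countFin {suc n} p = (if p zero then 1 else 0) + countFin (λ i → p (suc i))

sumFin : ∀ {n} → (Fin n → ℕ) → ℕ
sumFin {zero}  f = 0
sumFin {suc n} f = f zero + sumFin (λ i → f (suc i))

allFin : ∀ {n} → (Fin n → Bool) → Bool
allFin {zero}  p = true
allFin {suc n} p = p zero ∧ allFin (λ i → p (suc i))

edgeCount : ∀ {n} → Graph n → ℕ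
edgeCount {n} G = sumFin λ i → countFin λ j → (toℕ i <ᵇ toℕ j) ∧ adj G i j

degree : ∀ {n} → Graph n → Fin n → ℕ
degree G v = countFin (adj G v)

MaxDegree : ∀ {n} → Graph n → ℕ → Set
MaxDegree {n} G Δ = (∀ v → degree G v ≤ Δ) × Σ (Fin n) (λ v → degree G v ≡ Δ)

VSet : ℕ → Set
VSet n = Fin n → Bool

extend : ∀ {n} → Bool → VSet n → VSet (suc n)
extend b S zero    = b
extend b S (suc i) = S i

allSubsets : (n : ℕ) → List (VSet n)
allSubsets zero    = (λ ()) ∷ []
allSubsets (suc n) = concatMap (λ S → extend false S ∷ extend true S ∷ []) (allSubsets n)

isClique : ∀ {n} → Graph n → VSet n → Bool
isClique G S = allFin λ i → allFin λ j →
  not (S i ∧ S j) ∨ ⌊ i ≟ j ⌋ ∨ adj G i j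

countList : {A : Set} → (A → Bool) → List A → ℕ
countList p []       = 0
countList p (x ∷ xs) = (if p x then 1 else 0) + countList p xs

-- c(G): number of cliques, including the empty set and singletons
cliqueCount : ∀ {n} → Graph n → ℕ
cliqueCount {n} G = countList (isClique G) (allSubsets n)

{-# OPTIONS --safe #-}
-- The witness is the disjoint union of k copies of K_{Δ+1} and n − k(Δ+1) isolated vertices;
-- the hypothesis 2m ≤ Δn is exactly what makes room for the copies. A union of complete graphs
-- K_{t₁} ⊎ ⋯ ⊎ K_{tₗ} has Σ C(tᵢ,2) edges, degrees tᵢ − 1 and 1 + Σ (2^{tᵢ} − 1) cliques, since
-- every nonempty clique lies inside one component and every subset of a component is a clique.
-- The counts are obtained by adding one vertex v at a time: the cliques of G + v inside a vertex
-- set N are those of G inside N − v together with, when v ∈ N, the cliques of G inside N ∩ N(v)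
-- extended by v. Each K_{Δ+1} has 2^{Δ+1} − 1 nonempty cliques, Δ + 1 of them singletons.

module Submission where

open import Defs
open import Data.Bool using (Bool; true; false; _∧_; _∨_; not; if_then_else_)
open import Data.Bool.Properties using (∧-assoc; ∧-idem; ∧-zeroʳ; ∧-identityʳ; ∨-zeroʳ; ∨-distribˡ-∧)
open import Data.Fin using (Fin; zero; suc; _≟_; _↑ˡ_; _↑ʳ_; splitAt)
open import Data.Fin.Properties using (splitAt⁻¹-↑ˡ; splitAt⁻¹-↑ʳ)
open import Data.List using (List; []; _∷_; concatMap; map; replicate; _++_)
open import Data.List.Properties using (map-id)
open import Data.List.Relation.Unary.All using (All; []; _∷_)
open import Data.List.Relation.Unary.All.Properties using (++⁺; replicate⁺)
open import Data.Nat using (ℕ; zero; suc; _+_; _*_; _∸_; _^_; _≤_; _<_; z≤n; s≤s; s≤s⁻¹; >-nonZero)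
open import Data.Nat.Combinatorics using (_C_; nC1≡n; nCk+nC[k+1]≡[n+1]C[k+1])
open import Data.Nat.ListAction using (sum)
open import Data.Nat.Properties
  using (+-assoc; +-comm; +-identityʳ; *-identityʳ; *-zeroʳ; *-distribˡ-+; +-cancelʳ-≡; suc-injective;
         ≤-refl; ≤-reflexive; ≤-trans; +-mono-≤; m≤m+n; *-cancelˡ-≤; m^n>0; m∸n+n≡m; m+[n∸m]≡n)
open import Data.Nat.Tactic.RingSolver using (solve-∀)
open import Data.Product using (Σ; _×_; _,_)
open import Data.Sum using (inj₁; inj₂)
open import Function using (_∘_; id)
open import Relation.Binary.PropositionalEquality
  using (_≡_; refl; sym; trans; cong; cong₂; subst; module ≡-Reasoning)
open import Relation.Nullary.Decidable using (⌊_⌋; yes; no)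

open ≡-Reasoning

suc-C2 : ∀ t → suc t C 2 ≡ t + t C 2
suc-C2 t = trans (sym (nCk+nC[k+1]≡[n+1]C[k+1] t 1)) (cong (_+ t C 2) (nC1≡n t))

sum-map-replicate-++ : ∀ (f : ℕ → ℕ) k a r b →
  sum (map f (replicate k a ++ replicate r b)) ≡ k * f a + r * f b
sum-map-replicate-++ f zero    a zero    b = refl
sum-map-replicate-++ f zero    a (suc r) b = cong (f b +_) (sum-map-replicate-++ f zero a r b)
sum-map-replicate-++ f (suc k) a r       b =
  trans (cong (f a +_) (sum-map-replicate-++ f k a r b)) (sym (+-assoc (f a) (k * f a) (r * f b)))

2*[1+n]C2≡n*[1+n] : ∀ n → 2 * (suc n C 2) ≡ n * suc n
2*[1+n]C2≡n*[1+n] zero    = refl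
2*[1+n]C2≡n*[1+n] (suc n) = begin
  2 * (suc (suc n) C 2)         ≡⟨ cong (2 *_) (suc-C2 (suc n)) ⟩
  2 * (suc n + suc n C 2)       ≡⟨ *-distribˡ-+ 2 (suc n) (suc n C 2) ⟩
  2 * suc n + 2 * (suc n C 2)   ≡⟨ cong (2 * suc n +_) (2*[1+n]C2≡n*[1+n] n) ⟩
  2 * suc n + n * suc n         ≡⟨ expand n ⟩
  suc n * suc (suc n)           ∎
  where
  expand : ∀ n → 2 * suc n + n * suc n ≡ suc n * suc (suc n)
  expand = solve-∀

n<2^n : ∀ n → n < 2 ^ n
n<2^n zero    = s≤s z≤n
n<2^n (suc n) = +-mono-≤ (m^n>0 2 n) (≤-trans (n<2^n n) (m≤m+n (2 ^ n) 0))

m∸1≡[1+n]+[m∸n∸2] : ∀ {m} n → 2 + n ≤ m → m ∸ 1 ≡ suc n + (m ∸ n ∸ 2)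
m∸1≡[1+n]+[m∸n∸2] zero    (s≤s (s≤s _))   = refl
m∸1≡[1+n]+[m∸n∸2] (suc n) (s≤s 2+n≤m@(s≤s _)) = cong suc (m∸1≡[1+n]+[m∸n∸2] n 2+n≤m)

allFin-cong : ∀ {n} {p q : Fin n → Bool} → (∀ i → p i ≡ q i) → allFin p ≡ allFin q
allFin-cong {zero}  p≗q = refl
allFin-cong {suc n} p≗q = cong₂ _∧_ (p≗q zero) (allFin-cong (p≗q ∘ suc))

allFin-intro : ∀ {n} {p : Fin n → Bool} → (∀ i → p i ≡ true) → allFin p ≡ true
allFin-intro {zero}  p≡true = refl
allFin-intro {suc n} p≡true rewrite p≡true zero = allFin-intro (p≡true ∘ suc)

allFin-elim : ∀ {n} {p : Fin n → Bool} → allFin p ≡ true → ∀ i → p i ≡ true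
allFin-elim {suc n} {p} all≡true i with p zero in p₀
allFin-elim all≡true zero    | true = p₀
allFin-elim all≡true (suc i) | true = allFin-elim all≡true i

allFin-∧ : ∀ {n} (p q : Fin n → Bool) → allFin (λ i → p i ∧ q i) ≡ allFin p ∧ allFin q
allFin-∧ {zero}  p q = refl
allFin-∧ {suc n} p q = begin
  (p zero ∧ q zero) ∧ allFin (λ i → p (suc i) ∧ q (suc i))
    ≡⟨ cong ((p zero ∧ q zero) ∧_) (allFin-∧ (p ∘ suc) (q ∘ suc)) ⟩
  (p zero ∧ q zero) ∧ (allFin (p ∘ suc) ∧ allFin (q ∘ suc))
    ≡⟨ interchange (p zero) (q zero) _ _ ⟩
  (p zero ∧ allFin (p ∘ suc)) ∧ (q zero ∧ allFin (q ∘ suc)) ∎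
  where
  interchange : ∀ a b c d → (a ∧ b) ∧ (c ∧ d) ≡ (a ∧ c) ∧ (b ∧ d)
  interchange true  b true  d = refl
  interchange true  b false d = ∧-zeroʳ b
  interchange false b c     d = refl

countFin-cong : ∀ {n} {p q : Fin n → Bool} → (∀ i → p i ≡ q i) → countFin p ≡ countFin q
countFin-cong {zero}  p≗q = refl
countFin-cong {suc n} p≗q = cong₂ _+_ (cong (λ b → if b then 1 else 0) (p≗q zero)) (countFin-cong (p≗q ∘ suc))

countFin-false : ∀ n → countFin {n} (λ _ → false) ≡ 0
countFin-false zero    = refl
countFin-false (suc n) = countFin-false n

countFin-true : ∀ n → countFin {n} (λ _ → true) ≡ n
countFin-true zero    = refl
countFin-true (suc n) = cong suc (countFin-true n)

countList-cong : {A : Set} {p q : A → Bool} → (∀ x → p x ≡ q x) → ∀ xs → countList p xs ≡ countList q xs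
countList-cong p≗q []       = refl
countList-cong p≗q (x ∷ xs) = cong₂ _+_ (cong (λ b → if b then 1 else 0) (p≗q x)) (countList-cong p≗q xs)

countList-false : {A : Set} (xs : List A) → countList (λ _ → false) xs ≡ 0
countList-false []       = refl
countList-false (x ∷ xs) = countList-false xs

countList-∧ : {A : Set} (b : Bool) (p : A → Bool) (xs : List A) →
  countList (λ x → b ∧ p x) xs ≡ (if b then countList p xs else 0)
countList-∧ true  p xs = refl
countList-∧ false p xs = countList-false xs

countList-allSubsets-suc : ∀ {n} (p : VSet (suc n) → Bool) →
  countList p (allSubsets (suc n)) ≡
  countList (p ∘ extend false) (allSubsets n) + countList (p ∘ extend true) (allSubsets n)
countList-allSubsets-suc {n} p = go (allSubsets n)
  where
  [_] : Bool → ℕ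
  [ b ] = if b then 1 else 0
  go : ∀ Ss → countList p (concatMap (λ S → extend false S ∷ extend true S ∷ []) Ss) ≡
              countList (p ∘ extend false) Ss + countList (p ∘ extend true) Ss
  go []       = refl
  go (S ∷ Ss) = trans (cong (λ c → [ p (extend false S) ] + ([ p (extend true S) ] + c)) (go Ss))
                      (shuffle [ p (extend false S) ] [ p (extend true S) ] _ _)
    where
    shuffle : ∀ a b x y → a + (b + (x + y)) ≡ (a + x) + (b + y)
    shuffle = solve-∀

∅ : ∀ {n} → VSet n
∅ _ = false

full : ∀ {n} → VSet n
full _ = true

_∩_ : ∀ {n} → VSet n → VSet n → VSet n
(M ∩ N) i = M i ∧ N i

_⊆ᵇ_ : ∀ {n} → VSet n → VSet n → Bool
S ⊆ᵇ N = allFin λ i → not (S i) ∨ N i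

⊆ᵇ-∩ : ∀ {n} (S M N : VSet n) → S ⊆ᵇ (M ∩ N) ≡ S ⊆ᵇ M ∧ S ⊆ᵇ N
⊆ᵇ-∩ S M N = trans (allFin-cong (λ i → ∨-distribˡ-∧ (not (S i)) (M i) (N i)))
                   (allFin-∧ (λ i → not (S i) ∨ M i) (λ i → not (S i) ∨ N i))

⊆ᵇ∅⇒empty : ∀ {n} {S : VSet n} → S ⊆ᵇ ∅ ≡ true → ∀ i → S i ≡ false
⊆ᵇ∅⇒empty {S = S} S⊆∅ i with S i | allFin-elim S⊆∅ i
... | false | _ = refl

isClique-empty : ∀ {n} (G : Graph n) {S : VSet n} → (∀ i → S i ≡ false) → isClique G S ≡ true
isClique-empty G {S} S≡∅ = allFin-intro λ i → allFin-intro λ j → pairOK i j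
  where
  pairOK : ∀ i j → not (S i ∧ S j) ∨ ⌊ i ≟ j ⌋ ∨ adj G i j ≡ true
  pairOK i j rewrite S≡∅ i = refl

countList-⊆ᵇ∅ : ∀ n → countList (_⊆ᵇ ∅) (allSubsets n) ≡ 1
countList-⊆ᵇ∅ zero    = refl
countList-⊆ᵇ∅ (suc n) = begin
  countList (_⊆ᵇ ∅) (allSubsets (suc n))
    ≡⟨ countList-allSubsets-suc {n} (_⊆ᵇ ∅) ⟩
  countList (_⊆ᵇ ∅) (allSubsets n) + countList (λ _ → false) (allSubsets n)
    ≡⟨ cong₂ _+_ (countList-⊆ᵇ∅ n) (countList-false (allSubsets n)) ⟩
  1 ∎

cliquesIn : ∀ {n} → Graph n → VSet n → ℕ
cliquesIn {n} G N = countList (λ S → S ⊆ᵇ N ∧ isClique G S) (allSubsets n)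

cliquesIn-cong : ∀ {n} (G : Graph n) {N N′ : VSet n} → (∀ i → N i ≡ N′ i) → cliquesIn G N ≡ cliquesIn G N′
cliquesIn-cong {n} G N≗N′ =
  countList-cong (λ S → cong (_∧ isClique G S) (allFin-cong (λ i → cong (not (S i) ∨_) (N≗N′ i)))) (allSubsets n)

cliquesIn-∅ : ∀ {n} (G : Graph n) → cliquesIn G ∅ ≡ 1
cliquesIn-∅ {n} G = trans (countList-cong emptyOnly (allSubsets n)) (countList-⊆ᵇ∅ n)
  where
  emptyOnly : ∀ S → S ⊆ᵇ ∅ ∧ isClique G S ≡ S ⊆ᵇ ∅
  emptyOnly S with S ⊆ᵇ ∅ in S⊆∅
  ... | true  = isClique-empty G (⊆ᵇ∅⇒empty S⊆∅)
  ... | false = refl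

cliqueCount≡cliquesIn-full : ∀ {n} (G : Graph n) → cliqueCount G ≡ cliquesIn G full
cliqueCount≡cliquesIn-full {n} G = countList-cong
  (λ S → cong (_∧ isClique G S) (sym (allFin-intro (λ i → ∨-zeroʳ (not (S i)))))) (allSubsets n)

addVertex : ∀ {n} → VSet n → Graph n → Graph (suc n)
addVertex {n} M G = record { adj = A ; symm = A-symm ; irrefl = A-irrefl }
  where
  A : Fin (suc n) → Fin (suc n) → Bool
  A zero    zero    = false
  A zero    (suc j) = M j
  A (suc i) zero    = M i
  A (suc i) (suc j) = adj G i j
  A-symm : ∀ i j → A i j ≡ A j i
  A-symm zero    zero    = refl
  A-symm zero    (suc j) = refl
  A-symm (suc i) zero    = refl
  A-symm (suc i) (suc j) = symm G i j
  A-irrefl : ∀ i → A i i ≡ false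
  A-irrefl zero    = refl
  A-irrefl (suc i) = irrefl G i

-- Not definitional: ⌊_⌋ does not compute through the map′ in the suc case of _≟_.
≟-suc : ∀ {n} (i j : Fin n) → ⌊ suc i ≟ suc j ⌋ ≡ ⌊ i ≟ j ⌋
≟-suc i j with i ≟ j
... | yes _ = refl
... | no _  = refl

cliqueRow : ∀ {n} → Graph n → VSet n → Fin n → Bool
cliqueRow G S i = allFin λ j → not (S i ∧ S j) ∨ ⌊ i ≟ j ⌋ ∨ adj G i j

cliqueRow-addVertex : ∀ {n} (M : VSet n) (G : Graph n) (S : VSet n) (i : Fin n) →
  allFin (λ j → not (S i ∧ S j) ∨ ⌊ suc i ≟ suc j ⌋ ∨ adj (addVertex M G) (suc i) (suc j))
  ≡ cliqueRow G S i
cliqueRow-addVertex M G S i = allFin-cong (λ j → cong (λ e → not (S i ∧ S j) ∨ e ∨ adj G i j) (≟-suc i j))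

isClique-addVertex-false : ∀ {n} (M : VSet n) (G : Graph n) (S : VSet n) →
  isClique (addVertex M G) (extend false S) ≡ isClique G S
isClique-addVertex-false {n} M G S = cong₂ _∧_
  (allFin-intro {suc n} (λ _ → refl))
  (allFin-cong (λ i → cong₂ (λ b c → (not b ∨ M i) ∧ c) (∧-zeroʳ (S i)) (cliqueRow-addVertex M G S i)))

isClique-addVertex-true : ∀ {n} (M : VSet n) (G : Graph n) (S : VSet n) →
  isClique (addVertex M G) (extend true S) ≡ S ⊆ᵇ M ∧ isClique G S
isClique-addVertex-true M G S = begin
  S ⊆ᵇ M ∧ allFin (λ i → (not (S i ∧ true) ∨ M i) ∧
                          allFin (λ j → not (S i ∧ S j) ∨ ⌊ suc i ≟ suc j ⌋ ∨ adj G i j))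
    ≡⟨ cong (S ⊆ᵇ M ∧_) (allFin-cong (λ i →
         cong₂ (λ b c → (not b ∨ M i) ∧ c) (∧-identityʳ (S i)) (cliqueRow-addVertex M G S i))) ⟩
  S ⊆ᵇ M ∧ allFin (λ i → (not (S i) ∨ M i) ∧ cliqueRow G S i)
    ≡⟨ cong (S ⊆ᵇ M ∧_) (allFin-∧ (λ i → not (S i) ∨ M i) (cliqueRow G S)) ⟩
  S ⊆ᵇ M ∧ (S ⊆ᵇ M ∧ isClique G S)
    ≡⟨ sym (∧-assoc (S ⊆ᵇ M) _ _) ⟩
  (S ⊆ᵇ M ∧ S ⊆ᵇ M) ∧ isClique G S
    ≡⟨ cong (_∧ isClique G S) (∧-idem (S ⊆ᵇ M)) ⟩
  S ⊆ᵇ M ∧ isClique G S ∎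

cliquesIn-addVertex : ∀ {n} (M : VSet n) (G : Graph n) (N : VSet (suc n)) →
  cliquesIn (addVertex M G) N ≡
  cliquesIn G (N ∘ suc) + (if N zero then cliquesIn G (M ∩ (N ∘ suc)) else 0)
cliquesIn-addVertex {n} M G N = begin
  cliquesIn (addVertex M G) N
    ≡⟨ countList-allSubsets-suc (λ S → S ⊆ᵇ N ∧ isClique (addVertex M G) S) ⟩
  countList (λ S → S ⊆ᵇ (N ∘ suc) ∧ isClique (addVertex M G) (extend false S)) (allSubsets n) +
  countList (λ S → (N zero ∧ S ⊆ᵇ (N ∘ suc)) ∧ isClique (addVertex M G) (extend true S)) (allSubsets n)
    ≡⟨ cong₂ _+_ (countList-cong avoiding (allSubsets n)) (countList-cong through (allSubsets n)) ⟩
  cliquesIn G (N ∘ suc) + countList (λ S → N zero ∧ (S ⊆ᵇ (M ∩ (N ∘ suc)) ∧ isClique G S)) (allSubsets n)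
    ≡⟨ cong (cliquesIn G (N ∘ suc) +_) (countList-∧ (N zero) _ (allSubsets n)) ⟩
  cliquesIn G (N ∘ suc) + (if N zero then cliquesIn G (M ∩ (N ∘ suc)) else 0) ∎
  where
  rearrange : ∀ x b a c → (x ∧ b) ∧ (a ∧ c) ≡ x ∧ ((a ∧ b) ∧ c)
  rearrange false b     a     c = refl
  rearrange true  b     true  c = refl
  rearrange true  true  false c = refl
  rearrange true  false false c = refl
  avoiding : ∀ S → S ⊆ᵇ (N ∘ suc) ∧ isClique (addVertex M G) (extend false S) ≡ S ⊆ᵇ (N ∘ suc) ∧ isClique G S
  avoiding S = cong (S ⊆ᵇ (N ∘ suc) ∧_) (isClique-addVertex-false M G S)
  through : ∀ S → (N zero ∧ S ⊆ᵇ (N ∘ suc)) ∧ isClique (addVertex M G) (extend true S) ≡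
                  N zero ∧ (S ⊆ᵇ (M ∩ (N ∘ suc)) ∧ isClique G S)
  through S = begin
    (N zero ∧ S ⊆ᵇ (N ∘ suc)) ∧ isClique (addVertex M G) (extend true S)
      ≡⟨ cong ((N zero ∧ S ⊆ᵇ (N ∘ suc)) ∧_) (isClique-addVertex-true M G S) ⟩
    (N zero ∧ S ⊆ᵇ (N ∘ suc)) ∧ (S ⊆ᵇ M ∧ isClique G S)
      ≡⟨ rearrange (N zero) (S ⊆ᵇ (N ∘ suc)) (S ⊆ᵇ M) (isClique G S) ⟩
    N zero ∧ ((S ⊆ᵇ M ∧ S ⊆ᵇ (N ∘ suc)) ∧ isClique G S)
      ≡⟨ cong (λ b → N zero ∧ (b ∧ isClique G S)) (sym (⊆ᵇ-∩ S M (N ∘ suc))) ⟩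
    N zero ∧ (S ⊆ᵇ (M ∩ (N ∘ suc)) ∧ isClique G S) ∎

initial : ∀ {s} (t : ℕ) → VSet (t + s)
initial zero    _       = false
initial (suc t) zero    = true
initial (suc t) (suc i) = initial t i

initial-↑ˡ : ∀ {s} t (i : Fin t) → initial {s} t (i ↑ˡ s) ≡ true
initial-↑ˡ (suc t) zero    = refl
initial-↑ˡ (suc t) (suc i) = initial-↑ˡ t i

initial-↑ʳ : ∀ {s} t (x : Fin s) → initial {s} t (t ↑ʳ x) ≡ false
initial-↑ʳ zero    x = refl
initial-↑ʳ (suc t) x = initial-↑ʳ t x

countFin-initial : ∀ {s} t → countFin (initial {s} t) ≡ t
countFin-initial {s} zero = countFin-false s
countFin-initial (suc t) = cong suc (countFin-initial t)

-- addClique t X is K_t ⊎ X with the clique on the first t vertices: each new vertex is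
-- joined to the clique vertices added before it.
addClique : ∀ {s} (t : ℕ) → Graph s → Graph (t + s)
addClique zero    X = X
addClique (suc t) X = addVertex (initial t) (addClique t X)

edgeCount-addClique : ∀ {s} t (X : Graph s) → edgeCount (addClique t X) ≡ t C 2 + edgeCount X
edgeCount-addClique zero    X = refl
edgeCount-addClique (suc t) X = begin
  countFin (initial t) + edgeCount (addClique t X) ≡⟨ cong₂ _+_ (countFin-initial t) (edgeCount-addClique t X) ⟩
  t + (t C 2 + edgeCount X)                         ≡⟨ sym (+-assoc t (t C 2) (edgeCount X)) ⟩
  (t + t C 2) + edgeCount X                         ≡⟨ cong (_+ edgeCount X) (sym (suc-C2 t)) ⟩
  suc t C 2 + edgeCount X                           ∎

degree-addClique-↑ˡ : ∀ {s} t (X : Graph s) (i : Fin t) → suc (degree (addClique t X) (i ↑ˡ s)) ≡ t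
degree-addClique-↑ˡ (suc t) X zero = cong suc (countFin-initial t)
degree-addClique-↑ˡ {s} (suc t) X (suc i) rewrite initial-↑ˡ {s} t i = cong suc (degree-addClique-↑ˡ t X i)

degree-addClique-↑ʳ : ∀ {s} t (X : Graph s) (x : Fin s) → degree (addClique t X) (t ↑ʳ x) ≡ degree X x
degree-addClique-↑ʳ zero    X x = refl
degree-addClique-↑ʳ (suc t) X x rewrite initial-↑ʳ t x = degree-addClique-↑ʳ t X x

degree-addClique-≤ : ∀ {s Δ} t (X : Graph s) → t ≤ suc Δ → (∀ x → degree X x ≤ Δ) →
  ∀ v → degree (addClique t X) v ≤ Δ
degree-addClique-≤ {s} {Δ} t X t≤1+Δ degX≤Δ v with splitAt t v in v≡
... | inj₁ i = subst (λ w → degree (addClique t X) w ≤ Δ) (splitAt⁻¹-↑ˡ v≡)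
                     (s≤s⁻¹ (≤-trans (≤-reflexive (degree-addClique-↑ˡ t X i)) t≤1+Δ))
... | inj₂ x = subst (λ w → degree (addClique t X) w ≤ Δ) (splitAt⁻¹-↑ʳ v≡)
                     (subst (_≤ Δ) (sym (degree-addClique-↑ʳ t X x)) (degX≤Δ x))

-- A nonempty clique inside N meets K_t or X but not both, and those meeting K_t are the
-- 2 ^ |N ∩ K_t| − 1 nonempty subsets of N ∩ K_t; the + 1 avoids truncated subtraction.
cliquesIn-addClique : ∀ {s} t (X : Graph s) (N : VSet (t + s)) →
  cliquesIn (addClique t X) N + 1 ≡ 2 ^ countFin (λ i → N (i ↑ˡ s)) + cliquesIn X (λ x → N (t ↑ʳ x))
cliquesIn-addClique zero X N = +-comm (cliquesIn X N) 1
cliquesIn-addClique {s} (suc t) X N = begin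
  cliquesIn (addVertex (initial t) (addClique t X)) N + 1
    ≡⟨ cong (_+ 1) (cliquesIn-addVertex (initial t) (addClique t X) N) ⟩
  cliquesIn (addClique t X) (N ∘ suc)
    + (if N zero then cliquesIn (addClique t X) (initial t ∩ (N ∘ suc)) else 0) + 1
    ≡⟨ doubling (N zero) (cliquesIn-addClique t X (N ∘ suc)) insideClique ⟩
  2 ^ ((if N zero then 1 else 0) + countFin (λ i → N (suc (i ↑ˡ s)))) + cliquesIn X (λ x → N (suc t ↑ʳ x)) ∎
  where
  doubling : ∀ b {A B c Y} → A + 1 ≡ 2 ^ c + Y → B ≡ 2 ^ c →
             A + (if b then B else 0) + 1 ≡ 2 ^ ((if b then 1 else 0) + c) + Y
  doubling false {A} A+1≡ _ = trans (cong (_+ 1) (+-identityʳ A)) A+1≡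
  doubling true {A} {c = c} {Y} A+1≡ refl = begin
    A + 2 ^ c + 1       ≡⟨ reorder A (2 ^ c) ⟩
    2 ^ c + (A + 1)     ≡⟨ cong (2 ^ c +_) A+1≡ ⟩
    2 ^ c + (2 ^ c + Y) ≡⟨ collect (2 ^ c) Y ⟩
    2 * 2 ^ c + Y       ∎
    where
    reorder : ∀ a p → a + p + 1 ≡ p + (a + 1)
    reorder = solve-∀
    collect : ∀ p y → p + (p + y) ≡ 2 * p + y
    collect = solve-∀
  insideClique : cliquesIn (addClique t X) (initial t ∩ (N ∘ suc)) ≡ 2 ^ countFin (λ i → N (suc (i ↑ˡ s)))
  insideClique = +-cancelʳ-≡ _ _ _ (begin
    cliquesIn (addClique t X) (initial t ∩ (N ∘ suc)) + 1
      ≡⟨ cliquesIn-addClique t X (initial t ∩ (N ∘ suc)) ⟩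
    2 ^ countFin (λ i → initial t (i ↑ˡ s) ∧ N (suc (i ↑ˡ s)))
      + cliquesIn X (λ x → initial t (t ↑ʳ x) ∧ N (suc (t ↑ʳ x)))
      ≡⟨ cong₂ (λ c Y → 2 ^ c + Y)
           (countFin-cong (λ i → cong (_∧ N (suc (i ↑ˡ s))) (initial-↑ˡ t i)))
           (trans (cliquesIn-cong X (λ x → cong (_∧ N (suc (t ↑ʳ x))) (initial-↑ʳ t x))) (cliquesIn-∅ X)) ⟩
    2 ^ countFin (λ i → N (suc (i ↑ˡ s))) + 1 ∎)

emptyGraph : Graph 0
emptyGraph = record { adj = λ () ; symm = λ () ; irrefl = λ () }

cliqueUnion : (ts : List ℕ) → Graph (sum ts)
cliqueUnion []       = emptyGraph
cliqueUnion (t ∷ ts) = addClique t (cliqueUnion ts)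

edgeCount-cliqueUnion : ∀ ts → edgeCount (cliqueUnion ts) ≡ sum (map (_C 2) ts)
edgeCount-cliqueUnion []       = refl
edgeCount-cliqueUnion (t ∷ ts) =
  trans (edgeCount-addClique t (cliqueUnion ts)) (cong (t C 2 +_) (edgeCount-cliqueUnion ts))

degree-cliqueUnion-≤ : ∀ {Δ ts} → All (_≤ suc Δ) ts → ∀ v → degree (cliqueUnion ts) v ≤ Δ
degree-cliqueUnion-≤ []                        ()
degree-cliqueUnion-≤ {ts = t ∷ ts} (t≤ ∷ ts≤) =
  degree-addClique-≤ t (cliqueUnion ts) t≤ (degree-cliqueUnion-≤ ts≤)

cliqueCount-cliqueUnion : ∀ ts → cliqueCount (cliqueUnion ts) ≡ 1 + sum (map (λ t → 2 ^ t ∸ 1) ts)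
cliqueCount-cliqueUnion ts = trans (cliqueCount≡cliquesIn-full (cliqueUnion ts)) (cliquesIn-full ts)
  where
  cliquesIn-full : ∀ ts → cliquesIn (cliqueUnion ts) full ≡ 1 + sum (map (λ t → 2 ^ t ∸ 1) ts)
  cliquesIn-full []       = refl
  cliquesIn-full (t ∷ ts) = +-cancelʳ-≡ _ _ _ (begin
    cliquesIn (addClique t (cliqueUnion ts)) full + 1
      ≡⟨ cliquesIn-addClique t (cliqueUnion ts) full ⟩
    2 ^ countFin {t} full + cliquesIn (cliqueUnion ts) full
      ≡⟨ cong₂ (λ c Y → 2 ^ c + Y) (countFin-true t) (cliquesIn-full ts) ⟩
    2 ^ t + (1 + R)
      ≡⟨ cong (_+ (1 + R)) (sym (m∸n+n≡m (m^n>0 2 t))) ⟩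
    (2 ^ t ∸ 1 + 1) + (1 + R)
      ≡⟨ regroup (2 ^ t ∸ 1) R ⟩
    1 + (2 ^ t ∸ 1 + R) + 1 ∎)
    where
    R = sum (map (λ t → 2 ^ t ∸ 1) ts)
    regroup : ∀ a r → (a + 1) + (1 + r) ≡ 1 + (a + r) + 1
    regroup = solve-∀

cliquesAndIsolated : (k d r : ℕ) → List ℕ
cliquesAndIsolated k d r = replicate k d ++ replicate r 1

sum-cliquesAndIsolated : ∀ k d r → sum (cliquesAndIsolated k d r) ≡ k * d + r
sum-cliquesAndIsolated k d r = begin
  sum (cliquesAndIsolated k d r)          ≡⟨ cong sum (sym (map-id (cliquesAndIsolated k d r))) ⟩
  sum (map id (cliquesAndIsolated k d r)) ≡⟨ sum-map-replicate-++ id k d r 1 ⟩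
  k * d + r * 1                           ≡⟨ cong (k * d +_) (*-identityʳ r) ⟩
  k * d + r                               ∎

edgeCount-cliquesAndIsolated : ∀ k d r → edgeCount (cliqueUnion (cliquesAndIsolated k d r)) ≡ k * (d C 2)
edgeCount-cliquesAndIsolated k d r = begin
  edgeCount (cliqueUnion (cliquesAndIsolated k d r)) ≡⟨ edgeCount-cliqueUnion (cliquesAndIsolated k d r) ⟩
  sum (map (_C 2) (cliquesAndIsolated k d r))        ≡⟨ sum-map-replicate-++ (_C 2) k d r 1 ⟩
  k * (d C 2) + r * 0                                ≡⟨ cong (k * (d C 2) +_) (*-zeroʳ r) ⟩
  k * (d C 2) + 0                                    ≡⟨ +-identityʳ (k * (d C 2)) ⟩
  k * (d C 2)                                        ∎

cliqueCount-cliquesAndIsolated : ∀ k Δ r →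
  cliqueCount (cliqueUnion (cliquesAndIsolated k (suc Δ) r)) ≡ 1 + (k * suc Δ + r) + (2 ^ suc Δ ∸ Δ ∸ 2) * k
cliqueCount-cliquesAndIsolated k Δ r = begin
  cliqueCount (cliqueUnion (cliquesAndIsolated k (suc Δ) r))
    ≡⟨ cliqueCount-cliqueUnion (cliquesAndIsolated k (suc Δ) r) ⟩
  1 + sum (map (λ t → 2 ^ t ∸ 1) (cliquesAndIsolated k (suc Δ) r))
    ≡⟨ cong (1 +_) (sum-map-replicate-++ (λ t → 2 ^ t ∸ 1) k (suc Δ) r 1) ⟩
  1 + (k * (2 ^ suc Δ ∸ 1) + r * 1)
    ≡⟨ cong (λ c → 1 + (k * c + r * 1)) (m∸1≡[1+n]+[m∸n∸2] Δ (n<2^n (suc Δ))) ⟩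
  1 + (k * (suc Δ + (2 ^ suc Δ ∸ Δ ∸ 2)) + r * 1)
    ≡⟨ distribute k (suc Δ) (2 ^ suc Δ ∸ Δ ∸ 2) r ⟩
  1 + (k * suc Δ + r) + (2 ^ suc Δ ∸ Δ ∸ 2) * k ∎
  where
  distribute : ∀ k d e r → 1 + (k * (d + e) + r * 1) ≡ 1 + (k * d + r) + e * k
  distribute = solve-∀

clique-copies-fit : ∀ {Δ n} k → 1 ≤ Δ → 2 * (k * (suc Δ C 2)) ≤ Δ * n → k * suc Δ ≤ n
clique-copies-fit {Δ} k Δ≥1 2m≤Δn = *-cancelˡ-≤ Δ {{>-nonZero Δ≥1}} (≤-trans (≤-reflexive handshake) 2m≤Δn)
  where
  swap : ∀ a b c → a * (b * c) ≡ b * (a * c)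
  swap = solve-∀
  handshake : Δ * (k * suc Δ) ≡ 2 * (k * (suc Δ C 2))
  handshake = begin
    Δ * (k * suc Δ)           ≡⟨ swap Δ k (suc Δ) ⟩
    k * (Δ * suc Δ)           ≡⟨ cong (k *_) (sym (2*[1+n]C2≡n*[1+n] Δ)) ⟩
    k * (2 * (suc Δ C 2))     ≡⟨ swap k 2 (suc Δ C 2) ⟩
    2 * (k * (suc Δ C 2))     ∎

proposition1 : (Δ n m : ℕ) → 1 ≤ Δ → 1 ≤ m → 2 * m ≤ Δ * n →
    (k : ℕ) → m ≡ k * ((Δ + 1) C 2) →
    Σ (Graph n) (λ G → edgeCount G ≡ m × MaxDegree G Δ ×
      cliqueCount G ≡ 1 + n + (2 ^ (Δ + 1) ∸ Δ ∸ 2) * k)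
proposition1 Δ n .0 _ () _ zero refl
proposition1 Δ n _ Δ≥1 _ 2m≤Δn (suc k) refl with Δ + 1 | +-comm Δ 1
... | _ | refl = subst Witness vertices
  ( cliqueUnion ts
  , edgeCount-cliquesAndIsolated (suc k) (suc Δ) r
  , ( degree-cliqueUnion-≤ (++⁺ (replicate⁺ (suc k) ≤-refl) (replicate⁺ r (s≤s z≤n)))
    , zero , suc-injective (degree-addClique-↑ˡ (suc Δ) (cliqueUnion (cliquesAndIsolated k (suc Δ) r)) zero))
  , trans (cliqueCount-cliquesAndIsolated (suc k) Δ r)
          (cong (λ N → 1 + N + (2 ^ suc Δ ∸ Δ ∸ 2) * suc k) (sym (sum-cliquesAndIsolated (suc k) (suc Δ) r))))
  where
  r  = n ∸ suc k * suc Δ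
  ts = cliquesAndIsolated (suc k) (suc Δ) r
  Witness : ℕ → Set
  Witness N = Σ (Graph N) λ G → edgeCount G ≡ suc k * (suc Δ C 2) × MaxDegree G Δ ×
                                 cliqueCount G ≡ 1 + N + (2 ^ suc Δ ∸ Δ ∸ 2) * suc k
  vertices : sum ts ≡ n
  vertices = trans (sum-cliquesAndIsolated (suc k) (suc Δ) r) (m+[n∸m]≡n (clique-copies-fit (suc k) Δ≥1 2m≤Δn))
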